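{- If $\mathcal{K}$ is a $d$-dimensional cubical complex, then $$\sum_{j=0}^d h_j^{(sc)}(\mathcal{K})\lambda^{d-j} = \sum_{\substack{F\in\mathcal{K}\\ F\ne\emptyset}} (-1)^{d-\dim F-1}\,\widetilde{\chi}(\mathrm{lk}_{\mathcal{K}}(F))\,(2\lambda)^{\dim F}(1-\lambda)^{d-\dim F}.$$
   Context: A cubical complex is a finite collection $\mathcal{K}$ of subsets of a vertex set, ordered by inclusion, containing $\emptyset$ and all singletons, closed under intersection, and such that for each nonempty $F\in\mathcal{K}$ the interval $[\emptyset,F]$ is isomorphic to the face poset of a cube (of dimension $\dim F$). For a nonempty face $F$, $\mathrm{lk}_{\mathcal{K}}(F)=\{G\in\mathcal{K}:G\supseteq F\}$ is regarded as (the face poset of) a simplicial complex, where $F$ itself corresponds to the empty simplex and a face $G\supseteq F$ corresponds to a simplex of dimension $\dim G-\dim F-1$; $\widetilde{\chi}$ denotes reduced Euler characteristic, $\widetilde{\chi}(\Gamma)=\sum_{i\ge-1}(-1)^if_i(\Gamma)$ with $f_{ -1}=1$. With $f_i(\mathcal{K})$ the number of $i$-dimensional faces, the short cubical $h$-vector is defined by $\sum_{j=0}^d h_j^{(sc)}(\mathcal{K})\lambda^j = \sum_{i=0}^d f_i(\mathcal{K})(2\lambda)^i(1-\lambda)^{d-i}$. -}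

module Defs where

open import Data.Bool using (Bool; true; false; _∧_)
open import Data.Nat as ℕ using (ℕ; zero; suc; _≤_; _∸_)
open import Data.Integer as ℤ using (ℤ; +_; -_; _-_; ∣_∣)
open import Data.Fin using (Fin)
open import Data.Fin.Subset using (Subset; ⊥; ⁅_⁆; _∩_; _⊆_; Nonempty)
open import Data.Fin.Subset.Properties using (nonempty?; _⊆?_)
open import Data.Vec using (Vec; []; _∷_; lookup)
open import Data.List using (List; []; _∷_; _++_; map)
open import Data.Maybe using (Maybe; just; nothing)
open import Data.Product using (_×_; Σ; ∃)
open import Data.Sum using (_⊎_)
open import Data.Empty using () renaming (⊥ to Empty)
open import Data.Unit using (⊤)
open import Function.Bundles using (_⇔_)
open import Relation.Nullary using (does)
open import Relation.Binary.PropositionalEquality using (_≡_)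

-- Univariate polynomials over ℤ as coefficient lists (constant term first)

Poly : Set
Poly = List ℤ

infixl 6 _⊕_
infixl 7 _⊗_

_⊕_ : Poly → Poly → Poly
[] ⊕ q = q
(a ∷ p) ⊕ [] = a ∷ p
(a ∷ p) ⊕ (b ∷ q) = (a ℤ.+ b) ∷ (p ⊕ q)

scale : ℤ → Poly → Poly
scale c = map (c ℤ.*_)

_⊗_ : Poly → Poly → Poly
[] ⊗ q = []
(a ∷ p) ⊗ q = scale a q ⊕ ((+ 0) ∷ (p ⊗ q))

const : ℤ → Poly
const c = c ∷ []

X : Poly
X = (+ 0) ∷ (+ 1) ∷ []

_^ₚ_ : Poly → ℕ → Poly
p ^ₚ zero = const (+ 1)
p ^ₚ suc k = p ⊗ (p ^ₚ k)

coeff : Poly → ℕ → ℤ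
coeff [] j = + 0
coeff (a ∷ p) zero = a
coeff (a ∷ p) (suc j) = coeff p j

_≈ₚ_ : Poly → Poly → Set
p ≈ₚ q = ∀ j → coeff p j ≡ coeff q j

sgn : ℤ → ℤ
sgn e = (- (+ 1)) ℤ.^ ∣ e ∣

allSubsets : (n : ℕ) → List (Subset n)
allSubsets zero = [] ∷ []
allSubsets (suc n) = map (true ∷_) (allSubsets n) ++ map (false ∷_) (allSubsets n)

sumℤ : {A : Set} → List A → (A → Bool) → (A → ℤ) → ℤ
sumℤ [] P f = + 0
sumℤ (x ∷ xs) P f with P x
... | true = f x ℤ.+ sumℤ xs P f
... | false = sumℤ xs P f

sumP : {A : Set} → List A → (A → Bool) → (A → Poly) → Poly
sumP [] P f = []
sumP (x ∷ xs) P f with P x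
... | true = f x ⊕ sumP xs P f
... | false = sumP xs P f

sumRange : ℕ → (ℕ → Poly) → Poly
sumRange zero f = f 0
sumRange (suc d) f = sumRange d f ⊕ f (suc d)

-- Face poset of the k-cube [0,1]^k, including the empty face.
-- nothing = empty face; just v with v ∈ {0,1,*}^k (nothing = free coordinate *,
-- just b = coordinate fixed to b) is the nonempty face it describes.

CubeFace : ℕ → Set
CubeFace k = Maybe (Vec (Maybe Bool) k)

_≤c_ : {k : ℕ} → CubeFace k → CubeFace k → Set
nothing ≤c y = ⊤
just x ≤c nothing = Empty
_≤c_ {k} (just x) (just y) = ∀ (i : Fin k) → (lookup y i ≡ nothing) ⊎ (lookup x i ≡ lookup y i)

-- Poset isomorphism between the interval [∅,F] of K (faces of K contained in F,
-- ordered by inclusion) and the face poset of the k-cube.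

record IntervalIso {n : ℕ} (K : Subset n → Bool) (F : Subset n) (k : ℕ) : Set where
  field
    to      : Subset n → CubeFace k
    from    : CubeFace k → Subset n
    from-in : ∀ c → (K (from c) ≡ true) × (from c ⊆ F)
    to-from : ∀ c → to (from c) ≡ c
    from-to : ∀ G → K G ≡ true → G ⊆ F → from (to G) ≡ G
    mono    : ∀ G G' → K G ≡ true → G ⊆ F → K G' ≡ true → G' ⊆ F →
              (G ⊆ G') ⇔ (to G ≤c to G')

-- K is the (finite, decidable)
-- collection of faces.  dim F is the dimension of the cube to which [∅,F]
-- is isomorphic (uniquely determined, since that poset has 3^k+1 elements).

record CubicalComplex (n : ℕ) : Set where
  field
    K          : Subset n → Bool
    has-empty  : K ⊥ ≡ true
    has-single : ∀ (x : Fin n) → K ⁅ x ⁆ ≡ true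
    ∩-closed   : ∀ F G → K F ≡ true → K G ≡ true → K (F ∩ G) ≡ true
    dim        : Subset n → ℕ
    cube       : ∀ F → K F ≡ true → Nonempty F → IntervalIso K F (dim F)

module _ {n : ℕ} (C : CubicalComplex n) where
  open CubicalComplex C

  isNEFace : Subset n → Bool
  isNEFace F with K F | does (nonempty? F)
  ... | true | true = true
  ... | _ | _ = false

  IsDimension : ℕ → Set
  IsDimension d = (∀ F → K F ≡ true → Nonempty F → dim F ≤ d)
                × (Σ (Subset n) λ F → (K F ≡ true) × Nonempty F × (dim F ≡ d))

  fvec : ℕ → ℤ
  fvec i = sumℤ (allSubsets n) isNEFace (λ F → if-eq (dim F) i)
    where
    if-eq : ℕ → ℕ → ℤ
    if-eq a b with does (a ℕ.≟ b)
    ... | true = + 1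
    ... | false = + 0

  hPoly : ℕ → Poly
  hPoly d = sumRange d λ i →
    const (fvec i) ⊗ ((const (+ 2) ⊗ X) ^ₚ i) ⊗ ((const (+ 1) ⊕ scale (- (+ 1)) X) ^ₚ (d ∸ i))

  hsc : ℕ → ℕ → ℤ
  hsc d j = coeff (hPoly d) j

  -- reduced Euler characteristic of lk_K(F) = {G ∈ K : G ⊇ F}, where G has
  -- simplex dimension dim G - dim F - 1 (F itself is the empty simplex)
  χ̃lk : Subset n → ℤ
  χ̃lk F = sumℤ (allSubsets n) (λ G → isNEFace G ∧ does (F ⊆? G))
             (λ G → sgn ((+ dim G) - (+ dim F) - (+ 1)))

  LHS : ℕ → Poly
  LHS d = sumRange d λ j → const (hsc d j) ⊗ (X ^ₚ (d ∸ j))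

  RHS : ℕ → Poly
  RHS d = sumP (allSubsets n) isNEFace λ F →
    const (sgn ((+ d) - (+ dim F) - (+ 1)) ℤ.* χ̃lk F)
      ⊗ ((const (+ 2) ⊗ X) ^ₚ dim F)
      ⊗ ((const (+ 1) ⊕ scale (- (+ 1)) X) ^ₚ (d ∸ dim F))

-- Write t_i = (2λ)^i (1-λ)^(d-i), so that h(λ) = Σ_F t_(dim F). The left side is
-- λ^d h(1/λ), and λ^d t_i(1/λ) = (-1)^(d-i) 2^i (1-λ)^(d-i). On the right, expand χ̃(lk F) as a signed
-- sum over the faces G ⊇ F and exchange the sums: the two signs multiply to (-1)^(d - dim G), and since
-- [∅,G] is the face poset of a k-cube (k = dim G), Σ_{∅≠F⊆G} t_(dim F) = Σ_i C(k,i) 2^(k-i) t_i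
-- = 2^k (1-λ)^(d-k). Both sides thus equal Σ_G (-1)^(d - dim G) 2^(dim G) (1-λ)^(d - dim G).
-- The isomorphism [∅,G] ≅ cube preserves dimension because [∅,F] has exactly 3^(dim F) + 1 elements.

module Submission where

open import Defs
open import Data.Bool using (Bool; true; false; _∧_; _∨_)
import Data.Bool as Bool
open import Data.Fin.Properties using (all?)
open import Data.Fin.Subset using (Subset; ⊥; _⊆_; _∈_; Nonempty)
open import Data.Fin.Subset.Properties using (nonempty?; _⊆?_; ⊥⊆; ⊆-trans; Empty-unique; ∉⊥)
open import Data.Integer as ℤ using (ℤ; +_; -_; _+_; _*_; _-_)
import Data.Integer.Properties as ℤP
open import Data.Integer.Tactic.RingSolver using (solve-∀)
open import Data.List using (List; []; _∷_; _++_; map)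
open import Data.Maybe using (Maybe; just; nothing)
import Data.Maybe.Properties as MP
open import Data.Nat as ℕ using (ℕ; zero; suc; _∸_; _≤_; _<_; _≤?_; z≤n; s≤s)
open import Data.Nat.Combinatorics using (nCk≡nC[n∸k]; nCn≡1; nCk+nC[k+1]≡[n+1]C[k+1]; k>n⇒nCk≡0)
  renaming (_C_ to _choose_)
import Data.Nat.Properties as ℕP
open import Data.Product using (Σ; _×_; _,_; proj₁; proj₂)
open import Data.Sum using (inj₁; inj₂)
open import Data.Unit using (tt)
open import Data.Vec using (Vec; []; _∷_; lookup)
import Data.Vec.Properties as VP
open import Function.Bundles using (Equivalence; mk⇔; _⇔_)
open import Relation.Binary.Definitions using (Decidable; DecidableEquality)
open import Relation.Binary.PropositionalEquality
open import Relation.Nullary using (Dec; yes; no; does; ¬_; contradiction)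
open import Relation.Nullary.Decidable using (dec-true; dec-false; does-⇔; _⊎-dec_)

private variable
  A B : Set

∑ : List A → (A → ℤ) → ℤ
∑ [] f = + 0
∑ (x ∷ xs) f = f x + ∑ xs f

∑-cong : (xs : List A) {f g : A → ℤ} → (∀ x → f x ≡ g x) → ∑ xs f ≡ ∑ xs g
∑-cong [] f≗g = refl
∑-cong (x ∷ xs) f≗g = cong₂ _+_ (f≗g x) (∑-cong xs f≗g)

∑-zero : (xs : List A) → ∑ xs (λ _ → + 0) ≡ + 0
∑-zero [] = refl
∑-zero (x ∷ xs) = trans (ℤP.+-identityˡ _) (∑-zero xs)

∑-distrib-+ : (xs : List A) (f g : A → ℤ) → ∑ xs (λ x → f x + g x) ≡ ∑ xs f + ∑ xs g
∑-distrib-+ [] f g = refl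
∑-distrib-+ (x ∷ xs) f g =
  trans (cong (_+_ (f x + g x)) (∑-distrib-+ xs f g)) (interchange (f x) (g x) (∑ xs f) (∑ xs g))
  where
  interchange : ∀ a b c d → a + b + (c + d) ≡ a + c + (b + d)
  interchange = solve-∀

∑-*ˡ : (c : ℤ) (xs : List A) (f : A → ℤ) → c * ∑ xs f ≡ ∑ xs (λ x → c * f x)
∑-*ˡ c [] f = ℤP.*-zeroʳ c
∑-*ˡ c (x ∷ xs) f = trans (ℤP.*-distribˡ-+ c (f x) (∑ xs f)) (cong (_+_ (c * f x)) (∑-*ˡ c xs f))

∑-*ʳ : (c : ℤ) (xs : List A) (f : A → ℤ) → ∑ xs f * c ≡ ∑ xs (λ x → f x * c)
∑-*ʳ c xs f = begin
  ∑ xs f * c             ≡⟨ ℤP.*-comm (∑ xs f) c ⟩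
  c * ∑ xs f             ≡⟨ ∑-*ˡ c xs f ⟩
  ∑ xs (λ x → c * f x)   ≡⟨ ∑-cong xs (λ x → ℤP.*-comm c (f x)) ⟩
  ∑ xs (λ x → f x * c)   ∎
  where open ≡-Reasoning

∑-++ : (xs ys : List A) (f : A → ℤ) → ∑ (xs ++ ys) f ≡ ∑ xs f + ∑ ys f
∑-++ [] ys f = sym (ℤP.+-identityˡ _)
∑-++ (x ∷ xs) ys f = trans (cong (_+_ (f x)) (∑-++ xs ys f)) (sym (ℤP.+-assoc (f x) (∑ xs f) (∑ ys f)))

∑-map : (h : B → A) (xs : List B) (f : A → ℤ) → ∑ (map h xs) f ≡ ∑ xs (λ x → f (h x))
∑-map h [] f = refl
∑-map h (x ∷ xs) f = cong (_+_ (f (h x))) (∑-map h xs f)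

∑-comm : (xs : List A) (ys : List B) (g : A → B → ℤ) →
         ∑ xs (λ x → ∑ ys (g x)) ≡ ∑ ys (λ y → ∑ xs (λ x → g x y))
∑-comm [] ys g = sym (∑-zero ys)
∑-comm (x ∷ xs) ys g =
  trans (cong (_+_ (∑ ys (g x))) (∑-comm xs ys g)) (sym (∑-distrib-+ ys (g x) (λ y → ∑ xs (λ x → g x y))))

𝟙[_]_ : Bool → ℤ → ℤ
𝟙[ true ] z = z
𝟙[ false ] z = + 0

𝟙-zero : (b : Bool) → 𝟙[ b ] (+ 0) ≡ + 0
𝟙-zero true = refl
𝟙-zero false = refl

𝟙-cong : (b : Bool) {z w : ℤ} → z ≡ w → 𝟙[ b ] z ≡ 𝟙[ b ] w
𝟙-cong b = cong 𝟙[ b ]_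

𝟙-*ˡ : (c : ℤ) (b : Bool) (z : ℤ) → c * 𝟙[ b ] z ≡ 𝟙[ b ] (c * z)
𝟙-*ˡ c true z = refl
𝟙-*ˡ c false z = ℤP.*-zeroʳ c

𝟙-*ʳ : (c : ℤ) (b : Bool) (z : ℤ) → 𝟙[ b ] z * c ≡ 𝟙[ b ] (z * c)
𝟙-*ʳ c true z = refl
𝟙-*ʳ c false z = ℤP.*-zeroˡ c

𝟙-∧ : (a b : Bool) (z : ℤ) → 𝟙[ a ∧ b ] z ≡ 𝟙[ a ] 𝟙[ b ] z
𝟙-∧ true b z = refl
𝟙-∧ false b z = refl

𝟙²-*ˡ : (c : ℤ) (a b : Bool) (z : ℤ) → c * 𝟙[ a ] 𝟙[ b ] z ≡ 𝟙[ a ] 𝟙[ b ] (c * z)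
𝟙²-*ˡ c a b z = trans (𝟙-*ˡ c a _) (𝟙-cong a (𝟙-*ˡ c b z))

𝟙²-*ʳ : (c : ℤ) (a b : Bool) (z : ℤ) → 𝟙[ a ] 𝟙[ b ] z * c ≡ 𝟙[ a ] 𝟙[ b ] (z * c)
𝟙²-*ʳ c a b z = trans (𝟙-*ʳ c a _) (𝟙-cong a (𝟙-*ʳ c b z))

𝟙-comm : (a b : Bool) (z : ℤ) → 𝟙[ a ] 𝟙[ b ] z ≡ 𝟙[ b ] 𝟙[ a ] z
𝟙-comm true b z = refl
𝟙-comm false true z = refl
𝟙-comm false false z = refl

𝟙-∑ : (b : Bool) (xs : List A) (f : A → ℤ) → 𝟙[ b ] ∑ xs f ≡ ∑ xs (λ x → 𝟙[ b ] f x)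
𝟙-∑ true xs f = refl
𝟙-∑ false xs f = sym (∑-zero xs)

sumℤ≡∑ : (xs : List A) (P : A → Bool) (f : A → ℤ) → sumℤ xs P f ≡ ∑ xs (λ x → 𝟙[ P x ] f x)
sumℤ≡∑ [] P f = refl
sumℤ≡∑ (x ∷ xs) P f with P x
... | true = cong (_+_ (f x)) (sumℤ≡∑ xs P f)
... | false = trans (sumℤ≡∑ xs P f) (sym (ℤP.+-identityˡ _))

∑≤ : ℕ → (ℕ → ℤ) → ℤ
∑≤ zero g = g 0
∑≤ (suc d) g = ∑≤ d g + g (suc d)

∑≤-cong : (d : ℕ) {f g : ℕ → ℤ} → (∀ i → i ≤ d → f i ≡ g i) → ∑≤ d f ≡ ∑≤ d g
∑≤-cong zero f≗g = f≗g 0 z≤n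
∑≤-cong (suc d) f≗g = cong₂ _+_ (∑≤-cong d (λ i i≤d → f≗g i (ℕP.m≤n⇒m≤1+n i≤d))) (f≗g (suc d) ℕP.≤-refl)

∑≤-∑ : (d : ℕ) (xs : List A) (h : ℕ → A → ℤ) → ∑≤ d (λ i → ∑ xs (h i)) ≡ ∑ xs (λ x → ∑≤ d (λ i → h i x))
∑≤-∑ zero xs h = refl
∑≤-∑ (suc d) xs h =
  trans (cong (_+ ∑ xs (h (suc d))) (∑≤-∑ d xs h)) (sym (∑-distrib-+ xs (λ x → ∑≤ d (λ i → h i x)) (h (suc d))))

𝟙-∑≤ : (b : Bool) (d : ℕ) (g : ℕ → ℤ) → 𝟙[ b ] ∑≤ d g ≡ ∑≤ d (λ i → 𝟙[ b ] g i)
𝟙-∑≤ true d g = refl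
𝟙-∑≤ false zero g = refl
𝟙-∑≤ false (suc d) g = cong (_+ + 0) (𝟙-∑≤ false d g)

∑≤-δ : (a d : ℕ) (g : ℕ → ℤ) → ∑≤ d (λ i → 𝟙[ does (a ℕ.≟ i) ] g i) ≡ 𝟙[ does (a ≤? d) ] g a
∑≤-δ zero zero g = refl
∑≤-δ (suc a) zero g = refl
∑≤-δ a (suc d) g with a ℕ.≟ suc d
... | yes refl = begin
  ∑≤ d (λ i → 𝟙[ does (suc d ℕ.≟ i) ] g i) + 𝟙[ does (suc d ℕ.≟ suc d) ] g (suc d)
    ≡⟨ cong₂ _+_ (∑≤-δ (suc d) d g) (cong (λ b → 𝟙[ b ] g (suc d)) (dec-true (suc d ℕ.≟ suc d) refl)) ⟩
  𝟙[ does (suc d ≤? d) ] g (suc d) + g (suc d)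
    ≡⟨ cong (λ b → 𝟙[ b ] g (suc d) + g (suc d)) (dec-false (suc d ≤? d) ℕP.1+n≰n) ⟩
  + 0 + g (suc d)
    ≡⟨ ℤP.+-identityˡ _ ⟩
  g (suc d)
    ≡⟨ cong (λ b → 𝟙[ b ] g (suc d)) (dec-true (suc d ≤? suc d) ℕP.≤-refl) ⟨
  𝟙[ does (suc d ≤? suc d) ] g (suc d) ∎
  where open ≡-Reasoning
... | no a≢1+d = begin
  ∑≤ d (λ i → 𝟙[ does (a ℕ.≟ i) ] g i) + 𝟙[ does (a ℕ.≟ suc d) ] g (suc d)
    ≡⟨ cong₂ _+_ (∑≤-δ a d g) (cong (λ b → 𝟙[ b ] g (suc d)) (dec-false (a ℕ.≟ suc d) a≢1+d)) ⟩
  𝟙[ does (a ≤? d) ] g a + + 0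
    ≡⟨ ℤP.+-identityʳ _ ⟩
  𝟙[ does (a ≤? d) ] g a
    ≡⟨ cong (λ b → 𝟙[ b ] g a) (does-⇔ (mk⇔ ℕP.m≤n⇒m≤1+n ≤1+d⇒≤d) (a ≤? d) (a ≤? suc d)) ⟩
  𝟙[ does (a ≤? suc d) ] g a ∎
  where
  open ≡-Reasoning
  ≤1+d⇒≤d : a ≤ suc d → a ≤ d
  ≤1+d⇒≤d a≤1+d = ℕP.≤-pred (ℕP.≤∧≢⇒< a≤1+d a≢1+d)

shift : (ℕ → ℤ) → ℕ → ℤ
shift g zero = + 0
shift g (suc j) = g j

shift-cong : {g h : ℕ → ℤ} → (∀ j → g j ≡ h j) → ∀ j → shift g j ≡ shift h j
shift-cong g≗h zero = refl
shift-cong g≗h (suc j) = g≗h j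

shift-+ : (g h : ℕ → ℤ) → ∀ j → shift (λ i → g i + h i) j ≡ shift g j + shift h j
shift-+ g h zero = refl
shift-+ g h (suc j) = refl

shift-* : (c : ℤ) (g : ℕ → ℤ) → ∀ j → shift (λ i → c * g i) j ≡ c * shift g j
shift-* c g zero = sym (ℤP.*-zeroʳ c)
shift-* c g (suc j) = refl

shift-zero : ∀ j → shift (λ _ → + 0) j ≡ + 0
shift-zero zero = refl
shift-zero (suc j) = refl

∑-shift : (xs : List A) (g : A → ℕ → ℤ) → ∀ j → ∑ xs (λ x → shift (g x) j) ≡ shift (λ i → ∑ xs (λ x → g x i)) j
∑-shift xs g zero = ∑-zero xs
∑-shift xs g (suc j) = refl

-- p ⋆ g is the coefficient sequence of p times the power series with coefficients g.
infixr 7 _⋆_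
_⋆_ : Poly → (ℕ → ℤ) → ℕ → ℤ
([] ⋆ g) j = + 0
((a ∷ p) ⋆ g) j = a * g j + shift (p ⋆ g) j

coeff-⊕ : ∀ p q j → coeff (p ⊕ q) j ≡ coeff p j + coeff q j
coeff-⊕ [] q j = sym (ℤP.+-identityˡ _)
coeff-⊕ (a ∷ p) [] j = sym (ℤP.+-identityʳ _)
coeff-⊕ (a ∷ p) (b ∷ q) zero = refl
coeff-⊕ (a ∷ p) (b ∷ q) (suc j) = coeff-⊕ p q j

coeff-scale : ∀ c p j → coeff (scale c p) j ≡ c * coeff p j
coeff-scale c [] j = sym (ℤP.*-zeroʳ c)
coeff-scale c (a ∷ p) zero = refl
coeff-scale c (a ∷ p) (suc j) = coeff-scale c p j

coeff-cons-zero : ∀ p j → coeff (+ 0 ∷ p) j ≡ shift (coeff p) j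
coeff-cons-zero p zero = refl
coeff-cons-zero p (suc j) = refl

coeff-⊗ : ∀ p q j → coeff (p ⊗ q) j ≡ (p ⋆ coeff q) j
coeff-⊗ [] q j = refl
coeff-⊗ (a ∷ p) q j = begin
  coeff (scale a q ⊕ (+ 0 ∷ p ⊗ q)) j                ≡⟨ coeff-⊕ (scale a q) (+ 0 ∷ p ⊗ q) j ⟩
  coeff (scale a q) j + coeff (+ 0 ∷ p ⊗ q) j        ≡⟨ cong₂ _+_ (coeff-scale a q j) (coeff-cons-zero (p ⊗ q) j) ⟩
  a * coeff q j + shift (coeff (p ⊗ q)) j            ≡⟨ cong (_+_ (a * coeff q j)) (shift-cong (coeff-⊗ p q) j) ⟩
  a * coeff q j + shift (p ⋆ coeff q) j              ∎
  where open ≡-Reasoning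

⋆-⊕ : ∀ p q g j → ((p ⊕ q) ⋆ g) j ≡ (p ⋆ g) j + (q ⋆ g) j
⋆-⊕ [] q g j = sym (ℤP.+-identityˡ _)
⋆-⊕ (a ∷ p) [] g j = sym (ℤP.+-identityʳ _)
⋆-⊕ (a ∷ p) (b ∷ q) g j =
  trans (cong (_+_ ((a + b) * g j)) (trans (shift-cong (⋆-⊕ p q g) j) (shift-+ (p ⋆ g) (q ⋆ g) j)))
        (distrib a b (g j) (shift (p ⋆ g) j) (shift (q ⋆ g) j))
  where
  distrib : ∀ a b x y z → (a + b) * x + (y + z) ≡ (a * x + y) + (b * x + z)
  distrib = solve-∀

⋆-scale : ∀ c p g j → (scale c p ⋆ g) j ≡ c * (p ⋆ g) j
⋆-scale c [] g j = sym (ℤP.*-zeroʳ c)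
⋆-scale c (a ∷ p) g j =
  trans (cong (_+_ (c * a * g j)) (trans (shift-cong (⋆-scale c p g) j) (shift-* c (p ⋆ g) j)))
        (distrib c a (g j) (shift (p ⋆ g) j))
  where
  distrib : ∀ c a x y → c * a * x + c * y ≡ c * (a * x + y)
  distrib = solve-∀

⋆-⊗ : ∀ p q g j → ((p ⊗ q) ⋆ g) j ≡ (p ⋆ (q ⋆ g)) j
⋆-⊗ [] q g j = refl
⋆-⊗ (a ∷ p) q g j = begin
  ((scale a q ⊕ (+ 0 ∷ p ⊗ q)) ⋆ g) j
    ≡⟨ ⋆-⊕ (scale a q) (+ 0 ∷ p ⊗ q) g j ⟩
  (scale a q ⋆ g) j + (+ 0 * g j + shift ((p ⊗ q) ⋆ g) j)
    ≡⟨ cong₂ _+_ (⋆-scale a q g j) (cong (_+ shift ((p ⊗ q) ⋆ g) j) (ℤP.*-zeroˡ (g j))) ⟩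
  a * (q ⋆ g) j + (+ 0 + shift ((p ⊗ q) ⋆ g) j)
    ≡⟨ cong (_+_ (a * (q ⋆ g) j)) (trans (ℤP.+-identityˡ _) (shift-cong (⋆-⊗ p q g) j)) ⟩
  a * (q ⋆ g) j + shift (p ⋆ (q ⋆ g)) j ∎
  where open ≡-Reasoning

⋆-const : ∀ c g j → (const c ⋆ g) j ≡ c * g j
⋆-const c g j = trans (cong (_+_ (c * g j)) (shift-zero j)) (ℤP.+-identityʳ _)

⋆-X : ∀ g j → (X ⋆ g) j ≡ shift g j
⋆-X g j = begin
  + 0 * g j + shift (const (+ 1) ⋆ g) j   ≡⟨ cong (_+ shift (const (+ 1) ⋆ g) j) (ℤP.*-zeroˡ (g j)) ⟩
  + 0 + shift (const (+ 1) ⋆ g) j         ≡⟨ ℤP.+-identityˡ _ ⟩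
  shift (const (+ 1) ⋆ g) j               ≡⟨ shift-cong (λ i → trans (⋆-const (+ 1) g i) (ℤP.*-identityˡ (g i))) j ⟩
  shift g j                               ∎
  where open ≡-Reasoning

coeff-const⊗ : ∀ c p j → coeff (const c ⊗ p) j ≡ c * coeff p j
coeff-const⊗ c p j = trans (coeff-⊗ (const c) p j) (⋆-const c (coeff p) j)

coeff-const⊗⊗ : ∀ c p q j → coeff (const c ⊗ p ⊗ q) j ≡ c * (p ⋆ coeff q) j
coeff-const⊗⊗ c p q j = begin
  coeff (const c ⊗ p ⊗ q) j        ≡⟨ coeff-⊗ (const c ⊗ p) q j ⟩
  ((const c ⊗ p) ⋆ coeff q) j      ≡⟨ ⋆-⊗ (const c) p (coeff q) j ⟩
  (const c ⋆ (p ⋆ coeff q)) j      ≡⟨ ⋆-const c (p ⋆ coeff q) j ⟩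
  c * (p ⋆ coeff q) j              ∎
  where open ≡-Reasoning

coeff-X^ : ∀ k j → coeff (X ^ₚ k) j ≡ 𝟙[ does (j ℕ.≟ k) ] (+ 1)
coeff-X^ zero zero = refl
coeff-X^ zero (suc j) = refl
coeff-X^ (suc k) j = trans (coeff-⊗ X (X ^ₚ k) j) (trans (⋆-X (coeff (X ^ₚ k)) j) (shifted j))
  where
  shifted : ∀ j → shift (coeff (X ^ₚ k)) j ≡ 𝟙[ does (j ℕ.≟ suc k) ] (+ 1)
  shifted zero = refl
  shifted (suc j) = coeff-X^ k j

coeff-sumP : (xs : List A) (P : A → Bool) (f : A → Poly) (j : ℕ) →
  coeff (sumP xs P f) j ≡ ∑ xs (λ x → 𝟙[ P x ] coeff (f x) j)
coeff-sumP [] P f j = refl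
coeff-sumP (x ∷ xs) P f j with P x
... | true = trans (coeff-⊕ (f x) _ j) (cong (_+_ (coeff (f x) j)) (coeff-sumP xs P f j))
... | false = trans (coeff-sumP xs P f j) (sym (ℤP.+-identityˡ _))

coeff-sumRange : (d : ℕ) (f : ℕ → Poly) (j : ℕ) → coeff (sumRange d f) j ≡ ∑≤ d (λ i → coeff (f i) j)
coeff-sumRange zero f j = refl
coeff-sumRange (suc d) f j =
  trans (coeff-⊕ (sumRange d f) (f (suc d)) j) (cong (_+ coeff (f (suc d)) j) (coeff-sumRange d f j))

twoλ oneMinusλ : Poly
twoλ = const (+ 2) ⊗ X
oneMinusλ = const (+ 1) ⊕ scale (- (+ 1)) X

2^ : ℕ → ℤ
2^ i = + (2 ℕ.^ i)

sgnℕ : ℕ → ℤ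
sgnℕ k = (- (+ 1)) ℤ.^ k

sgnℕ-+ : ∀ a b → sgnℕ (a ℕ.+ b) ≡ sgnℕ a * sgnℕ b
sgnℕ-+ = ℤP.^-distribˡ-+-* (- (+ 1))

sgnℕ-square : ∀ a → sgnℕ a * sgnℕ a ≡ + 1
sgnℕ-square zero = refl
sgnℕ-square (suc a) = trans (negate-both (sgnℕ a)) (sgnℕ-square a)
  where
  negate-both : ∀ x → (- (+ 1)) * x * ((- (+ 1)) * x) ≡ x * x
  negate-both = solve-∀

sgnℕ-∸ : ∀ {a b} → b ≤ a → sgnℕ (a ∸ b) ≡ sgnℕ a * sgnℕ b
sgnℕ-∸ {a} {b} b≤a = begin
  sgnℕ (a ∸ b)                        ≡⟨ ℤP.*-identityʳ _ ⟨
  sgnℕ (a ∸ b) * + 1                  ≡⟨ cong (sgnℕ (a ∸ b) *_) (sgnℕ-square b) ⟨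
  sgnℕ (a ∸ b) * (sgnℕ b * sgnℕ b)    ≡⟨ ℤP.*-assoc (sgnℕ (a ∸ b)) (sgnℕ b) (sgnℕ b) ⟨
  sgnℕ (a ∸ b) * sgnℕ b * sgnℕ b      ≡⟨ cong (_* sgnℕ b) (sgnℕ-+ (a ∸ b) b) ⟨
  sgnℕ (a ∸ b ℕ.+ b) * sgnℕ b         ≡⟨ cong (λ k → sgnℕ k * sgnℕ b) (ℕP.m∸n+n≡m b≤a) ⟩
  sgnℕ a * sgnℕ b                     ∎
  where open ≡-Reasoning

sgn-pred : ∀ {a b} → b ≤ a → sgn (+ a - + b - + 1) ≡ - sgnℕ (a ∸ b)
sgn-pred {a} {b} b≤a rewrite ℤP.m-n≡m⊖n a b | ℤP.⊖-≥ b≤a = pred-sign (a ∸ b)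
  where
  pred-sign : ∀ m → sgn (+ m - + 1) ≡ - sgnℕ m
  pred-sign zero = refl
  pred-sign (suc m) = sym (double-negation (sgnℕ m))
    where
    double-negation : ∀ x → - ((- (+ 1)) * x) ≡ x
    double-negation = solve-∀

sgn-product : ∀ {a b d} → b ≤ a → a ≤ d → sgn (+ d - + b - + 1) * sgn (+ a - + b - + 1) ≡ sgnℕ (d ∸ a)
sgn-product {a} {b} {d} b≤a a≤d = begin
  sgn (+ d - + b - + 1) * sgn (+ a - + b - + 1)         ≡⟨ cong₂ _*_ (sgn-pred (ℕP.≤-trans b≤a a≤d)) (sgn-pred b≤a) ⟩
  - sgnℕ (d ∸ b) * - sgnℕ (a ∸ b)                       ≡⟨ cong (λ e → - sgnℕ e * - sgnℕ (a ∸ b)) d∸b≡d∸a+a∸b ⟩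
  - sgnℕ (d ∸ a ℕ.+ (a ∸ b)) * - sgnℕ (a ∸ b)           ≡⟨ cong (λ s → - s * - sgnℕ (a ∸ b)) (sgnℕ-+ (d ∸ a) (a ∸ b)) ⟩
  - (sgnℕ (d ∸ a) * sgnℕ (a ∸ b)) * - sgnℕ (a ∸ b)      ≡⟨ cancel-signs (sgnℕ (d ∸ a)) (sgnℕ (a ∸ b)) ⟩
  sgnℕ (d ∸ a) * (sgnℕ (a ∸ b) * sgnℕ (a ∸ b))          ≡⟨ cong (sgnℕ (d ∸ a) *_) (sgnℕ-square (a ∸ b)) ⟩
  sgnℕ (d ∸ a) * + 1                                    ≡⟨ ℤP.*-identityʳ _ ⟩
  sgnℕ (d ∸ a)                                          ∎
  where
  open ≡-Reasoning
  d∸b≡d∸a+a∸b : d ∸ b ≡ d ∸ a ℕ.+ (a ∸ b)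
  d∸b≡d∸a+a∸b = trans (cong (_∸ b) (sym (ℕP.m∸n+n≡m a≤d))) (ℕP.+-∸-assoc (d ∸ a) b≤a)
  cancel-signs : ∀ x y → - (x * y) * - y ≡ x * (y * y)
  cancel-signs = solve-∀

⋆-twoλ : ∀ g j → (twoλ ⋆ g) j ≡ + 2 * shift g j
⋆-twoλ g j = begin
  + 0 * g j + shift (const (+ 2) ⋆ g) j   ≡⟨ cong (_+ shift (const (+ 2) ⋆ g) j) (ℤP.*-zeroˡ (g j)) ⟩
  + 0 + shift (const (+ 2) ⋆ g) j         ≡⟨ ℤP.+-identityˡ _ ⟩
  shift (const (+ 2) ⋆ g) j               ≡⟨ shift-cong (⋆-const (+ 2) g) j ⟩
  shift (λ i → + 2 * g i) j               ≡⟨ shift-* (+ 2) g j ⟩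
  + 2 * shift g j                         ∎
  where open ≡-Reasoning

⋆-oneMinusλ : ∀ g j → (oneMinusλ ⋆ g) j ≡ g j - shift g j
⋆-oneMinusλ g zero = begin
  + 1 * g 0 + + 0   ≡⟨ ℤP.+-identityʳ _ ⟩
  + 1 * g 0         ≡⟨ ℤP.*-identityˡ (g 0) ⟩
  g 0               ≡⟨ ℤP.+-identityʳ _ ⟨
  g 0 - + 0         ∎
  where open ≡-Reasoning
⋆-oneMinusλ g (suc j) =
  trans (cong (λ z → + 1 * g (suc j) + (- (+ 1) * g j + z)) (shift-zero j)) (simplify (g (suc j)) (g j))
  where
  simplify : ∀ a b → + 1 * a + (- (+ 1) * b + + 0) ≡ a - b
  simplify = solve-∀

⋆-twoλ^ : ∀ i g m → ((twoλ ^ₚ i) ⋆ g) m ≡ 𝟙[ does (i ≤? m) ] (2^ i * g (m ∸ i))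
⋆-twoλ^ zero g m = ⋆-const (+ 1) g m
⋆-twoλ^ (suc i) g m = trans (⋆-⊗ twoλ (twoλ ^ₚ i) g m) (trans (⋆-twoλ _ m) (twice-shifted m))
  where
  twice-shifted : ∀ m → + 2 * shift ((twoλ ^ₚ i) ⋆ g) m ≡ 𝟙[ does (suc i ≤? m) ] (2^ (suc i) * g (m ∸ suc i))
  twice-shifted zero = refl
  twice-shifted (suc m) = begin
    + 2 * ((twoλ ^ₚ i) ⋆ g) m                              ≡⟨ cong (+ 2 *_) (⋆-twoλ^ i g m) ⟩
    + 2 * 𝟙[ does (i ≤? m) ] (2^ i * g (m ∸ i))            ≡⟨ 𝟙-*ˡ (+ 2) (does (i ≤? m)) _ ⟩
    𝟙[ does (i ≤? m) ] (+ 2 * (2^ i * g (m ∸ i)))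
      ≡⟨ cong₂ 𝟙[_]_ (does-⇔ (mk⇔ s≤s ℕ.s≤s⁻¹) (i ≤? m) (suc i ≤? suc m)) doubling ⟩
    𝟙[ does (suc i ≤? suc m) ] (2^ (suc i) * g (m ∸ i))    ∎
    where
    open ≡-Reasoning
    doubling : + 2 * (2^ i * g (m ∸ i)) ≡ 2^ (suc i) * g (m ∸ i)
    doubling = trans (sym (ℤP.*-assoc (+ 2) (2^ i) (g (m ∸ i)))) (cong (_* g (m ∸ i)) (sym (ℤP.pos-* 2 (2 ℕ.^ i))))

coeff-oneMinusλ^-suc : ∀ e j → coeff (oneMinusλ ^ₚ suc e) j ≡ coeff (oneMinusλ ^ₚ e) j - shift (coeff (oneMinusλ ^ₚ e)) j
coeff-oneMinusλ^-suc e j = trans (coeff-⊗ oneMinusλ (oneMinusλ ^ₚ e) j) (⋆-oneMinusλ (coeff (oneMinusλ ^ₚ e)) j)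

coeff-oneMinusλ^ : ∀ e j → coeff (oneMinusλ ^ₚ e) j ≡ sgnℕ j * + (e choose j)
coeff-oneMinusλ^ zero zero = refl
coeff-oneMinusλ^ zero (suc j) = sym (ℤP.*-zeroʳ (sgnℕ (suc j)))
coeff-oneMinusλ^ (suc e) j = trans (coeff-oneMinusλ^-suc e j) (pascal j)
  where
  choose0 : ∀ n → n choose 0 ≡ 1
  choose0 n = trans (nCk≡nC[n∸k] {k = 0} {n = n} z≤n) (nCn≡1 n)
  pascal : ∀ j → coeff (oneMinusλ ^ₚ e) j - shift (coeff (oneMinusλ ^ₚ e)) j ≡ sgnℕ j * + (suc e choose j)
  pascal zero = begin
    coeff (oneMinusλ ^ₚ e) 0 - + 0   ≡⟨ ℤP.+-identityʳ _ ⟩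
    coeff (oneMinusλ ^ₚ e) 0         ≡⟨ coeff-oneMinusλ^ e 0 ⟩
    + 1 * + (e choose 0)             ≡⟨ cong (λ c → + 1 * + c) (trans (choose0 e) (sym (choose0 (suc e)))) ⟩
    + 1 * + (suc e choose 0)         ∎
    where open ≡-Reasoning
  pascal (suc j) = begin
    coeff (oneMinusλ ^ₚ e) (suc j) - coeff (oneMinusλ ^ₚ e) j
      ≡⟨ cong₂ _-_ (coeff-oneMinusλ^ e (suc j)) (coeff-oneMinusλ^ e j) ⟩
    (- (+ 1)) * sgnℕ j * + (e choose suc j) - sgnℕ j * + (e choose j)
      ≡⟨ collect (sgnℕ j) (+ (e choose j)) (+ (e choose suc j)) ⟩
    sgnℕ (suc j) * (+ (e choose j) + + (e choose suc j))
      ≡⟨ cong (sgnℕ (suc j) *_) (trans (sym (ℤP.pos-+ (e choose j) (e choose suc j))) (cong +_ (nCk+nC[k+1]≡[n+1]C[k+1] e j))) ⟩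
    sgnℕ (suc j) * + (suc e choose suc j) ∎
    where
    open ≡-Reasoning
    collect : ∀ x a b → (- (+ 1)) * x * b - x * a ≡ (- (+ 1)) * x * (a + b)
    collect = solve-∀

coeff-oneMinusλ^-vanish : ∀ {e j} → e < j → coeff (oneMinusλ ^ₚ e) j ≡ + 0
coeff-oneMinusλ^-vanish {e} {j} e<j = begin
  coeff (oneMinusλ ^ₚ e) j    ≡⟨ coeff-oneMinusλ^ e j ⟩
  sgnℕ j * + (e choose j)     ≡⟨ cong (λ c → sgnℕ j * + c) (k>n⇒nCk≡0 e<j) ⟩
  sgnℕ j * + 0                ≡⟨ ℤP.*-zeroʳ (sgnℕ j) ⟩
  + 0                         ∎
  where open ≡-Reasoning

coeff-oneMinusλ^-reflect : ∀ {e j} → j ≤ e → coeff (oneMinusλ ^ₚ e) (e ∸ j) ≡ sgnℕ e * coeff (oneMinusλ ^ₚ e) j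
coeff-oneMinusλ^-reflect {e} {j} j≤e = begin
  coeff (oneMinusλ ^ₚ e) (e ∸ j)           ≡⟨ coeff-oneMinusλ^ e (e ∸ j) ⟩
  sgnℕ (e ∸ j) * + (e choose (e ∸ j))      ≡⟨ cong₂ (λ s c → s * + c) (sgnℕ-∸ j≤e) (sym (nCk≡nC[n∸k] j≤e)) ⟩
  sgnℕ e * sgnℕ j * + (e choose j)         ≡⟨ ℤP.*-assoc (sgnℕ e) (sgnℕ j) _ ⟩
  sgnℕ e * (sgnℕ j * + (e choose j))       ≡⟨ cong (sgnℕ e *_) (coeff-oneMinusλ^ e j) ⟨
  sgnℕ e * coeff (oneMinusλ ^ₚ e) j        ∎
  where open ≡-Reasoning

faceTerm cubeTerm : ℕ → ℕ → ℕ → ℤ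
faceTerm d i = (twoλ ^ₚ i) ⋆ coeff (oneMinusλ ^ₚ (d ∸ i))
cubeTerm d i j = 2^ i * coeff (oneMinusλ ^ₚ (d ∸ i)) j

-- λ^d·f(1/λ) for f = (2λ)^i (1-λ)^(d-i) is 2^i (λ-1)^(d-i) = (-1)^(d-i) 2^i (1-λ)^(d-i).
faceTerm-reflect : ∀ {d i} j → i ≤ d → 𝟙[ does (j ≤? d) ] faceTerm d i (d ∸ j) ≡ sgnℕ (d ∸ i) * cubeTerm d i j
faceTerm-reflect {d} {i} j i≤d with ℕP.≤-<-connex j (d ∸ i)
... | inj₁ j≤d∸i = begin
  𝟙[ does (j ≤? d) ] faceTerm d i (d ∸ j)           ≡⟨ cong (𝟙[_] faceTerm d i (d ∸ j)) (dec-true (j ≤? d) j≤d) ⟩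
  faceTerm d i (d ∸ j)                              ≡⟨ ⋆-twoλ^ i c (d ∸ j) ⟩
  𝟙[ does (i ≤? d ∸ j) ] (2^ i * c (d ∸ j ∸ i))
    ≡⟨ cong₂ (λ b k → 𝟙[ b ] (2^ i * c k)) (dec-true (i ≤? d ∸ j) i≤d∸j) d∸j∸i≡d∸i∸j ⟩
  2^ i * c (d ∸ i ∸ j)                              ≡⟨ cong (2^ i *_) (coeff-oneMinusλ^-reflect j≤d∸i) ⟩
  2^ i * (sgnℕ (d ∸ i) * c j)                       ≡⟨ ℤP.*-assoc (2^ i) (sgnℕ (d ∸ i)) (c j) ⟨
  2^ i * sgnℕ (d ∸ i) * c j                         ≡⟨ cong (_* c j) (ℤP.*-comm (2^ i) (sgnℕ (d ∸ i))) ⟩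
  sgnℕ (d ∸ i) * 2^ i * c j                         ≡⟨ ℤP.*-assoc (sgnℕ (d ∸ i)) (2^ i) (c j) ⟩
  sgnℕ (d ∸ i) * cubeTerm d i j                     ∎
  where
  open ≡-Reasoning
  c : ℕ → ℤ
  c = coeff (oneMinusλ ^ₚ (d ∸ i))
  j≤d : j ≤ d
  j≤d = ℕP.≤-trans j≤d∸i (ℕP.m∸n≤m d i)
  i≤d∸j : i ≤ d ∸ j
  i≤d∸j = ℕP.m+n≤o⇒m≤o∸n i (subst (_≤ d) (ℕP.+-comm j i) (ℕP.m≤o∸n⇒m+n≤o j i≤d j≤d∸i))
  d∸j∸i≡d∸i∸j : d ∸ j ∸ i ≡ d ∸ i ∸ j
  d∸j∸i≡d∸i∸j = trans (ℕP.∸-+-assoc d j i) (trans (cong (d ∸_) (ℕP.+-comm j i)) (sym (ℕP.∸-+-assoc d i j)))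
... | inj₂ d∸i<j = trans lhs≡0 (sym rhs≡0)
  where
  c : ℕ → ℤ
  c = coeff (oneMinusλ ^ₚ (d ∸ i))
  rhs≡0 : sgnℕ (d ∸ i) * cubeTerm d i j ≡ + 0
  rhs≡0 = begin
    sgnℕ (d ∸ i) * (2^ i * c j)     ≡⟨ cong (λ z → sgnℕ (d ∸ i) * (2^ i * z)) (coeff-oneMinusλ^-vanish d∸i<j) ⟩
    sgnℕ (d ∸ i) * (2^ i * + 0)     ≡⟨ cong (sgnℕ (d ∸ i) *_) (ℤP.*-zeroʳ (2^ i)) ⟩
    sgnℕ (d ∸ i) * + 0              ≡⟨ ℤP.*-zeroʳ (sgnℕ (d ∸ i)) ⟩
    + 0                             ∎
    where open ≡-Reasoning
  i≰d∸j : j ≤ d → ¬ i ≤ d ∸ j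
  i≰d∸j j≤d i≤d∸j = ℕP.<⇒≱ d∸i<j (ℕP.m+n≤o⇒m≤o∸n j (subst (_≤ d) (ℕP.+-comm i j) (ℕP.m≤o∸n⇒m+n≤o i j≤d i≤d∸j)))
  lhs≡0 : 𝟙[ does (j ≤? d) ] faceTerm d i (d ∸ j) ≡ + 0
  lhs≡0 with j ≤? d
  ... | no j≰d = cong (𝟙[_] faceTerm d i (d ∸ j)) (dec-false (j ≤? d) j≰d)
  ... | yes j≤d = begin
    𝟙[ does (j ≤? d) ] faceTerm d i (d ∸ j)         ≡⟨ cong (𝟙[_] faceTerm d i (d ∸ j)) (dec-true (j ≤? d) j≤d) ⟩
    faceTerm d i (d ∸ j)                            ≡⟨ ⋆-twoλ^ i c (d ∸ j) ⟩
    𝟙[ does (i ≤? d ∸ j) ] (2^ i * c (d ∸ j ∸ i))   ≡⟨ cong (𝟙[_] (2^ i * c (d ∸ j ∸ i))) (dec-false (i ≤? d ∸ j) (i≰d∸j j≤d)) ⟩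
    + 0                                             ∎
    where open ≡-Reasoning

CubeVec : ℕ → Set
CubeVec k = Vec (Maybe Bool) k

cubeFaces : (k : ℕ) → List (CubeVec k)
cubeFaces zero = [] ∷ []
cubeFaces (suc k) = map (just true ∷_) (cubeFaces k) ++ map (just false ∷_) (cubeFaces k) ++ map (nothing ∷_) (cubeFaces k)

freeCoords : {k : ℕ} → CubeVec k → ℕ
freeCoords [] = 0
freeCoords (just b ∷ v) = freeCoords v
freeCoords (nothing ∷ v) = suc (freeCoords v)

freeCoords≤ : {k : ℕ} (v : CubeVec k) → freeCoords v ≤ k
freeCoords≤ [] = z≤n
freeCoords≤ (just b ∷ v) = ℕP.m≤n⇒m≤1+n (freeCoords≤ v)
freeCoords≤ (nothing ∷ v) = s≤s (freeCoords≤ v)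

∑-cubeFaces-suc : ∀ k (f : CubeVec (suc k) → ℤ) → ∑ (cubeFaces (suc k)) f ≡
  ∑ (cubeFaces k) (λ v → f (just true ∷ v))
    + (∑ (cubeFaces k) (λ v → f (just false ∷ v)) + ∑ (cubeFaces k) (λ v → f (nothing ∷ v)))
∑-cubeFaces-suc k f = begin
  ∑ (map (just true ∷_) Q ++ map (just false ∷_) Q ++ map (nothing ∷_) Q) f
    ≡⟨ ∑-++ (map (just true ∷_) Q) _ f ⟩
  ∑ (map (just true ∷_) Q) f + ∑ (map (just false ∷_) Q ++ map (nothing ∷_) Q) f
    ≡⟨ cong (_+_ (∑ (map (just true ∷_) Q) f)) (∑-++ (map (just false ∷_) Q) _ f) ⟩
  ∑ (map (just true ∷_) Q) f + (∑ (map (just false ∷_) Q) f + ∑ (map (nothing ∷_) Q) f)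
    ≡⟨ cong₂ _+_ (∑-map _ Q f) (cong₂ _+_ (∑-map _ Q f) (∑-map _ Q f)) ⟩
  ∑ Q (λ v → f (just true ∷ v)) + (∑ Q (λ v → f (just false ∷ v)) + ∑ Q (λ v → f (nothing ∷ v))) ∎
  where
  open ≡-Reasoning
  Q : List (CubeVec k)
  Q = cubeFaces k

-- Coordinatewise: two fixed values contribute 2(1-λ), a free one 2λ, together 2.
∑-faceTerm-cube : ∀ k e j → ∑ (cubeFaces k) (λ v → faceTerm (e ℕ.+ k) (freeCoords v) j) ≡ 2^ k * coeff (oneMinusλ ^ₚ e) j
∑-faceTerm-cube zero e j rewrite ℕP.+-identityʳ e = trans (ℤP.+-identityʳ _) (⋆-const (+ 1) (coeff (oneMinusλ ^ₚ e)) j)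
∑-faceTerm-cube (suc k) e j rewrite ℕP.+-suc e k = begin
  ∑ (cubeFaces (suc k)) (λ v → faceTerm (suc (e ℕ.+ k)) (freeCoords v) j)
    ≡⟨ ∑-cubeFaces-suc k _ ⟩
  fixed + (fixed + ∑ Q (λ v → faceTerm (suc (e ℕ.+ k)) (suc (freeCoords v)) j))
    ≡⟨ cong₂ (λ a b → a + (a + b)) (∑-faceTerm-cube k (suc e) j) free ⟩
  2^ k * c (suc e) j + (2^ k * c (suc e) j + + 2 * shift (λ i → 2^ k * c e i) j)
    ≡⟨ cong (λ x → 2^ k * x + (2^ k * x + + 2 * shift (λ i → 2^ k * c e i) j)) (coeff-oneMinusλ^-suc e j) ⟩
  2^ k * (c e j - shift (c e) j) + (2^ k * (c e j - shift (c e) j) + + 2 * shift (λ i → 2^ k * c e i) j)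
    ≡⟨ cong (λ x → 2^ k * (c e j - shift (c e) j) + (2^ k * (c e j - shift (c e) j) + + 2 * x)) (shift-* (2^ k) (c e) j) ⟩
  2^ k * (c e j - shift (c e) j) + (2^ k * (c e j - shift (c e) j) + + 2 * (2^ k * shift (c e) j))
    ≡⟨ telescope (2^ k) (c e j) (shift (c e) j) ⟩
  + 2 * 2^ k * c e j
    ≡⟨ cong (_* c e j) (ℤP.pos-* 2 (2 ℕ.^ k)) ⟨
  2^ (suc k) * c e j ∎
  where
  open ≡-Reasoning
  Q : List (CubeVec k)
  Q = cubeFaces k
  c : ℕ → ℕ → ℤ
  c e = coeff (oneMinusλ ^ₚ e)
  fixed : ℤ
  fixed = ∑ Q (λ v → faceTerm (suc (e ℕ.+ k)) (freeCoords v) j)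
  free : ∑ Q (λ v → faceTerm (suc (e ℕ.+ k)) (suc (freeCoords v)) j) ≡ + 2 * shift (λ i → 2^ k * c e i) j
  free = begin
    ∑ Q (λ v → faceTerm (suc (e ℕ.+ k)) (suc (freeCoords v)) j)
      ≡⟨ ∑-cong Q (λ v → trans (⋆-⊗ twoλ (twoλ ^ₚ freeCoords v) _ j) (⋆-twoλ _ j)) ⟩
    ∑ Q (λ v → + 2 * shift (faceTerm (e ℕ.+ k) (freeCoords v)) j)
      ≡⟨ ∑-*ˡ (+ 2) Q _ ⟨
    + 2 * ∑ Q (λ v → shift (faceTerm (e ℕ.+ k) (freeCoords v)) j)
      ≡⟨ cong (+ 2 *_) (∑-shift Q (λ v → faceTerm (e ℕ.+ k) (freeCoords v)) j) ⟩
    + 2 * shift (λ i → ∑ Q (λ v → faceTerm (e ℕ.+ k) (freeCoords v) i)) j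
      ≡⟨ cong (+ 2 *_) (shift-cong (∑-faceTerm-cube k e) j) ⟩
    + 2 * shift (λ i → 2^ k * c e i) j ∎
  telescope : ∀ p x y → p * (x - y) + (p * (x - y) + + 2 * (p * y)) ≡ + 2 * p * x
  telescope = solve-∀

∑-faceTerm-cube-≤ : ∀ {k d} j → k ≤ d → ∑ (cubeFaces k) (λ v → faceTerm d (freeCoords v) j) ≡ cubeTerm d k j
∑-faceTerm-cube-≤ {k} {d} j k≤d =
  subst (λ D → ∑ (cubeFaces k) (λ v → faceTerm D (freeCoords v) j) ≡ cubeTerm d k j)
    (ℕP.m∸n+n≡m k≤d) (∑-faceTerm-cube k (d ∸ k) j)

module _ {A : Set} (_≟_ : DecidableEquality A) where

  multiplicity : List A → A → ℤ
  multiplicity xs a = ∑ xs (λ x → 𝟙[ does (x ≟ a) ] (+ 1))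

  Enumerates : List A → Set
  Enumerates xs = ∀ a → multiplicity xs a ≡ + 1

  ∑-δ : (xs : List A) → Enumerates xs → ∀ a (g : A → ℤ) → ∑ xs (λ x → 𝟙[ does (x ≟ a) ] g x) ≡ g a
  ∑-δ xs enum a g = begin
    ∑ xs (λ x → 𝟙[ does (x ≟ a) ] g x)           ≡⟨ ∑-cong xs at-a ⟩
    ∑ xs (λ x → 𝟙[ does (x ≟ a) ] (+ 1) * g a)   ≡⟨ ∑-*ʳ (g a) xs _ ⟨
    multiplicity xs a * g a                      ≡⟨ cong (_* g a) (enum a) ⟩
    + 1 * g a                                    ≡⟨ ℤP.*-identityˡ (g a) ⟩
    g a                                          ∎
    where
    open ≡-Reasoning
    at-a : ∀ x → 𝟙[ does (x ≟ a) ] g x ≡ 𝟙[ does (x ≟ a) ] (+ 1) * g a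
    at-a x with x ≟ a
    ... | yes refl = sym (ℤP.*-identityˡ (g x))
    ... | no _ = sym (ℤP.*-zeroˡ (g a))

multiplicity-∷ : {A : Set} (_≟_ : DecidableEquality A) {k : ℕ} (xs : List (Vec A k)) (c b : A) (a : Vec A k) →
  ∑ xs (λ x → 𝟙[ does (VP.≡-dec _≟_ (c ∷ x) (b ∷ a)) ] (+ 1)) ≡ 𝟙[ does (c ≟ b) ] multiplicity (VP.≡-dec _≟_) xs a
multiplicity-∷ _≟_ xs c b a =
  trans (∑-cong xs (λ x → 𝟙-∧ (does (c ≟ b)) _ (+ 1))) (sym (𝟙-∑ (does (c ≟ b)) xs _))

_≟ᵐ_ : DecidableEquality (Maybe Bool)
_≟ᵐ_ = MP.≡-dec Bool._≟_

_≟ˢ_ : {n : ℕ} → DecidableEquality (Subset n)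
_≟ˢ_ = VP.≡-dec Bool._≟_

_≟ᶜ_ : {k : ℕ} → DecidableEquality (CubeVec k)
_≟ᶜ_ = VP.≡-dec _≟ᵐ_

_≟ᶠ_ : {k : ℕ} → DecidableEquality (CubeFace k)
_≟ᶠ_ = MP.≡-dec _≟ᶜ_

_≤c?_ : {k : ℕ} → Decidable (_≤c_ {k})
nothing ≤c? c = yes tt
just v ≤c? nothing = no λ ()
just v ≤c? just w = all? λ i → (lookup w i ≟ᵐ nothing) ⊎-dec (lookup v i ≟ᵐ lookup w i)

∑-allSubsets-suc : ∀ n (f : Subset (suc n) → ℤ) →
  ∑ (allSubsets (suc n)) f ≡ ∑ (allSubsets n) (λ x → f (true ∷ x)) + ∑ (allSubsets n) (λ x → f (false ∷ x))
∑-allSubsets-suc n f = trans (∑-++ (map (true ∷_) (allSubsets n)) _ f)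
  (cong₂ _+_ (∑-map _ (allSubsets n) f) (∑-map _ (allSubsets n) f))

allSubsets-enumerates : ∀ n → Enumerates _≟ˢ_ (allSubsets n)
allSubsets-enumerates zero [] = refl
allSubsets-enumerates (suc n) (b ∷ a) = begin
  multiplicity _≟ˢ_ (allSubsets (suc n)) (b ∷ a)
    ≡⟨ trans (∑-allSubsets-suc n _) (cong₂ _+_ (multiplicity-∷ Bool._≟_ S true b a) (multiplicity-∷ Bool._≟_ S false b a)) ⟩
  𝟙[ does (true Bool.≟ b) ] m + 𝟙[ does (false Bool.≟ b) ] m
    ≡⟨ exactly-one b ⟩
  m ≡⟨ allSubsets-enumerates n a ⟩
  + 1 ∎
  where
  open ≡-Reasoning
  S : List (Subset n)
  S = allSubsets n
  m : ℤ
  m = multiplicity _≟ˢ_ S a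
  exactly-one : ∀ b → 𝟙[ does (true Bool.≟ b) ] m + 𝟙[ does (false Bool.≟ b) ] m ≡ m
  exactly-one true = ℤP.+-identityʳ m
  exactly-one false = ℤP.+-identityˡ m

cubeFaces-enumerates : ∀ k → Enumerates _≟ᶜ_ (cubeFaces k)
cubeFaces-enumerates zero [] = refl
cubeFaces-enumerates (suc k) (b ∷ a) = begin
  multiplicity _≟ᶜ_ (cubeFaces (suc k)) (b ∷ a)
    ≡⟨ trans (∑-cubeFaces-suc k _) (cong₂ _+_ (multiplicity-∷ _≟ᵐ_ Q (just true) b a)
         (cong₂ _+_ (multiplicity-∷ _≟ᵐ_ Q (just false) b a) (multiplicity-∷ _≟ᵐ_ Q nothing b a))) ⟩
  𝟙[ does (just true ≟ᵐ b) ] m + (𝟙[ does (just false ≟ᵐ b) ] m + 𝟙[ does (nothing ≟ᵐ b) ] m)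
    ≡⟨ exactly-one b ⟩
  m ≡⟨ cubeFaces-enumerates k a ⟩
  + 1 ∎
  where
  open ≡-Reasoning
  Q : List (CubeVec k)
  Q = cubeFaces k
  m : ℤ
  m = multiplicity _≟ᶜ_ Q a
  exactly-one : ∀ b → 𝟙[ does (just true ≟ᵐ b) ] m + (𝟙[ does (just false ≟ᵐ b) ] m + 𝟙[ does (nothing ≟ᵐ b) ] m) ≡ m
  exactly-one (just true) = trans (cong (_+_ m) (ℤP.+-identityʳ (+ 0))) (ℤP.+-identityʳ m)
  exactly-one (just false) = trans (ℤP.+-identityˡ _) (ℤP.+-identityʳ m)
  exactly-one nothing = trans (ℤP.+-identityˡ _) (ℤP.+-identityˡ m)

allCubeFaces : (k : ℕ) → List (CubeFace k)
allCubeFaces k = nothing ∷ map just (cubeFaces k)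

allCubeFaces-enumerates : ∀ k → Enumerates _≟ᶠ_ (allCubeFaces k)
allCubeFaces-enumerates k nothing = begin
  + 1 + ∑ (map just (cubeFaces k)) (λ c → 𝟙[ does (c ≟ᶠ nothing) ] (+ 1))
    ≡⟨ cong (_+_ (+ 1)) (trans (∑-map just (cubeFaces k) _) (∑-zero (cubeFaces k))) ⟩
  + 1 + + 0                                                                 ≡⟨ ℤP.+-identityʳ (+ 1) ⟩
  + 1                                                                       ∎
  where open ≡-Reasoning
allCubeFaces-enumerates k (just a) =
  trans (ℤP.+-identityˡ _) (trans (∑-map just (cubeFaces k) _) (cubeFaces-enumerates k a))

triple : ∀ m → + m + (+ m + + m) ≡ + (3 ℕ.* m)
triple m = begin
  + m + (+ m + + m)           ≡⟨ cong (_+_ (+ m)) (ℤP.pos-+ m m) ⟨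
  + m + + (m ℕ.+ m)           ≡⟨ ℤP.pos-+ m (m ℕ.+ m) ⟨
  + (m ℕ.+ (m ℕ.+ m))         ≡⟨ cong (λ z → + (m ℕ.+ (m ℕ.+ z))) (ℕP.+-identityʳ m) ⟨
  + (3 ℕ.* m)                 ∎
  where open ≡-Reasoning

∑-cubeFaces-1 : ∀ k → ∑ (cubeFaces k) (λ _ → + 1) ≡ + (3 ℕ.^ k)
∑-cubeFaces-1 zero = refl
∑-cubeFaces-1 (suc k) =
  trans (∑-cubeFaces-suc k _) (trans (cong₂ _+_ IH (cong₂ _+_ IH IH)) (triple (3 ℕ.^ k)))
  where
  IH : ∑ (cubeFaces k) (λ _ → + 1) ≡ + (3 ℕ.^ k)
  IH = ∑-cubeFaces-1 k

∑-cubeFaces-≤ : ∀ k (w : CubeVec k) → ∑ (cubeFaces k) (λ v → 𝟙[ does (just v ≤c? just w) ] (+ 1)) ≡ + (3 ℕ.^ freeCoords w)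
∑-cubeFaces-≤ zero [] = refl
∑-cubeFaces-≤ (suc k) (y ∷ w) = trans (∑-cubeFaces-suc k _) (by-first-coordinate y)
  where
  Q : List (CubeVec k)
  Q = cubeFaces k
  IH : ∑ Q (λ v → 𝟙[ does (just v ≤c? just w) ] (+ 1)) ≡ + (3 ℕ.^ freeCoords w)
  IH = ∑-cubeFaces-≤ k w
  ∑≤w : Bool → ℤ
  ∑≤w b = ∑ Q (λ v → 𝟙[ b ∧ does (just v ≤c? just w) ] (+ 1))
  ∑≤w-false : ∑≤w false ≡ + 0
  ∑≤w-false = ∑-zero Q
  by-first-coordinate : ∀ y → ∑≤w (does (y ≟ᵐ nothing) ∨ does (just true ≟ᵐ y))
                              + (∑≤w (does (y ≟ᵐ nothing) ∨ does (just false ≟ᵐ y))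
                              + ∑≤w (does (y ≟ᵐ nothing) ∨ does (nothing ≟ᵐ y)))
                            ≡ + (3 ℕ.^ freeCoords (y ∷ w))
  by-first-coordinate nothing = trans (cong₂ _+_ IH (cong₂ _+_ IH IH)) (triple (3 ℕ.^ freeCoords w))
  by-first-coordinate (just true) rewrite IH | ∑≤w-false = ℤP.+-identityʳ _
  by-first-coordinate (just false) rewrite IH | ∑≤w-false = trans (ℤP.+-identityˡ _) (ℤP.+-identityʳ _)

1<3^[1+n] : ∀ n → 1 < 3 ℕ.^ suc n
1<3^[1+n] n = ℕP.<-≤-trans (s≤s (s≤s z≤n)) (ℕP.*-monoʳ-≤ 3 (ℕP.m^n>0 3 n))

3^-injective : ∀ a b → 3 ℕ.^ a ≡ 3 ℕ.^ b → a ≡ b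
3^-injective zero zero eq = refl
3^-injective zero (suc b) eq = contradiction eq (ℕP.<⇒≢ (1<3^[1+n] b))
3^-injective (suc a) zero eq = contradiction (sym eq) (ℕP.<⇒≢ (1<3^[1+n] a))
3^-injective (suc a) (suc b) eq = cong suc (3^-injective a b (ℕP.*-cancelˡ-≡ (3 ℕ.^ a) (3 ℕ.^ b) 3 eq))

module Complex {n : ℕ} (C : CubicalComplex n) where
  open CubicalComplex C

  subsets : List (Subset n)
  subsets = allSubsets n

  isNEFace-sound : ∀ H → isNEFace C H ≡ true → (K H ≡ true) × Nonempty H
  isNEFace-sound H eq with K H | nonempty? H
  ... | true | yes ne = refl , ne

  𝟙-isNEFace : ∀ H z → 𝟙[ isNEFace C H ] z ≡ 𝟙[ K H ] 𝟙[ does (nonempty? H) ] z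
  𝟙-isNEFace H z with K H | does (nonempty? H)
  ... | true | true = refl
  ... | true | false = refl
  ... | false | true = refl
  ... | false | false = refl

  module Interval (G : Subset n) (KG : K G ≡ true) (neG : Nonempty G) where
    open IntervalIso (cube G KG neG)

    k : ℕ
    k = dim G

    to-⊥ : to ⊥ ≡ nothing
    to-⊥ = below-nothing (subst (to ⊥ ≤c_) (to-from nothing) (Equivalence.to ⊥≤from-nothing (⊥⊆ {p = from nothing})))
      where
      below-nothing : ∀ {c : CubeFace k} → c ≤c nothing → c ≡ nothing
      below-nothing {nothing} _ = refl
      ⊥≤from-nothing : (⊥ ⊆ from nothing) ⇔ (to ⊥ ≤c to (from nothing))
      ⊥≤from-nothing = mono ⊥ (from nothing) has-empty ⊥⊆ (proj₁ (from-in nothing)) (proj₂ (from-in nothing))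

    from-nothing : from nothing ≡ ⊥
    from-nothing = trans (cong from (sym to-⊥)) (from-to ⊥ has-empty ⊥⊆)

    from-just-nonempty : ∀ v → Nonempty (from (just v))
    from-just-nonempty v with nonempty? (from (just v))
    ... | yes ne = ne
    ... | no empty with () ← trans (sym (to-from (just v))) (trans (cong to (Empty-unique empty)) to-⊥)

    -- On the interval, c = to H exactly when H = from c.
    δ-transport : ∀ c H z → 𝟙[ K H ] 𝟙[ does (H ⊆? G) ] 𝟙[ does (c ≟ᶠ to H) ] z ≡ 𝟙[ does (H ≟ˢ from c) ] z
    δ-transport c H z with H ≟ˢ from c
    δ-transport c .(from c) z | yes refl
      rewrite proj₁ (from-in c) | dec-true (from c ⊆? G) (proj₂ (from-in c)) | to-from c | dec-true (c ≟ᶠ c) refl = refl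
    ... | no H≢from-c with K H in KH
    ...   | false = refl
    ...   | true with H ⊆? G
    ...     | no _ = refl
    ...     | yes H⊆G
        rewrite dec-false (c ≟ᶠ to H) (λ c≡to-H → H≢from-c (trans (sym (from-to H KH H⊆G)) (cong from (sym c≡to-H)))) = refl

    ∑-interval : ∀ (ψ : Subset n → ℤ) → ∑ subsets (λ H → 𝟙[ K H ] 𝟙[ does (H ⊆? G) ] ψ H)
      ≡ ∑ (allCubeFaces k) (λ c → ψ (from c))
    ∑-interval ψ = begin
      ∑ subsets (λ H → 𝟙[ K H ] 𝟙[ does (H ⊆? G) ] ψ H)
        ≡⟨ ∑-cong subsets (λ H → cong (λ z → 𝟙[ K H ] 𝟙[ does (H ⊆? G) ] z)
            (sym (∑-δ _≟ᶠ_ (allCubeFaces k) (allCubeFaces-enumerates k) (to H) (λ _ → ψ H)))) ⟩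
      ∑ subsets (λ H → 𝟙[ K H ] 𝟙[ does (H ⊆? G) ] ∑ (allCubeFaces k) (λ c → 𝟙[ does (c ≟ᶠ to H) ] ψ H))
        ≡⟨ ∑-cong subsets (λ H → trans (𝟙-cong (K H) (𝟙-∑ (does (H ⊆? G)) (allCubeFaces k) _)) (𝟙-∑ (K H) (allCubeFaces k) _)) ⟩
      ∑ subsets (λ H → ∑ (allCubeFaces k) (λ c → 𝟙[ K H ] 𝟙[ does (H ⊆? G) ] 𝟙[ does (c ≟ᶠ to H) ] ψ H))
        ≡⟨ ∑-comm subsets (allCubeFaces k) _ ⟩
      ∑ (allCubeFaces k) (λ c → ∑ subsets (λ H → 𝟙[ K H ] 𝟙[ does (H ⊆? G) ] 𝟙[ does (c ≟ᶠ to H) ] ψ H))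
        ≡⟨ ∑-cong (allCubeFaces k) (λ c → ∑-cong subsets (λ H → δ-transport c H (ψ H))) ⟩
      ∑ (allCubeFaces k) (λ c → ∑ subsets (λ H → 𝟙[ does (H ≟ˢ from c) ] ψ H))
        ≡⟨ ∑-cong (allCubeFaces k) (λ c → ∑-δ _≟ˢ_ subsets (allSubsets-enumerates n) (from c) ψ) ⟩
      ∑ (allCubeFaces k) (λ c → ψ (from c)) ∎
      where open ≡-Reasoning

    ∑-interval-nonempty : ∀ (ψ : Subset n → ℤ) →
      ∑ subsets (λ H → 𝟙[ isNEFace C H ] 𝟙[ does (H ⊆? G) ] ψ H) ≡ ∑ (cubeFaces k) (λ v → ψ (from (just v)))
    ∑-interval-nonempty ψ = begin
      ∑ subsets (λ H → 𝟙[ isNEFace C H ] 𝟙[ does (H ⊆? G) ] ψ H)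
        ≡⟨ ∑-cong subsets (λ H → trans (𝟙-isNEFace H _) (𝟙-cong (K H) (𝟙-comm (does (nonempty? H)) (does (H ⊆? G)) (ψ H)))) ⟩
      ∑ subsets (λ H → 𝟙[ K H ] 𝟙[ does (H ⊆? G) ] ψ′ H)
        ≡⟨ ∑-interval ψ′ ⟩
      ψ′ (from nothing) + ∑ (map just (cubeFaces k)) (λ c → ψ′ (from c))
        ≡⟨ cong₂ _+_ ψ′-from-nothing (∑-map just (cubeFaces k) (λ c → ψ′ (from c))) ⟩
      + 0 + ∑ (cubeFaces k) (λ v → ψ′ (from (just v)))
        ≡⟨ ℤP.+-identityˡ _ ⟩
      ∑ (cubeFaces k) (λ v → ψ′ (from (just v)))
        ≡⟨ ∑-cong (cubeFaces k) (λ v → cong (𝟙[_] ψ (from (just v))) (dec-true (nonempty? _) (from-just-nonempty v))) ⟩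
      ∑ (cubeFaces k) (λ v → ψ (from (just v))) ∎
      where
      open ≡-Reasoning
      ψ′ : Subset n → ℤ
      ψ′ H = 𝟙[ does (nonempty? H) ] ψ H
      ψ′-from-nothing : ψ′ (from nothing) ≡ + 0
      ψ′-from-nothing rewrite from-nothing = cong (𝟙[_] ψ ⊥) (dec-false (nonempty? (⊥ {n})) λ (_ , x∈⊥) → ∉⊥ x∈⊥)

    size : ∑ subsets (λ H → 𝟙[ K H ] 𝟙[ does (H ⊆? G) ] (+ 1)) ≡ + suc (3 ℕ.^ k)
    size = begin
      ∑ subsets (λ H → 𝟙[ K H ] 𝟙[ does (H ⊆? G) ] (+ 1))   ≡⟨ ∑-interval (λ _ → + 1) ⟩
      + 1 + ∑ (map just (cubeFaces k)) (λ _ → + 1)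
        ≡⟨ cong (_+_ (+ 1)) (trans (∑-map just (cubeFaces k) _) (∑-cubeFaces-1 k)) ⟩
      + 1 + + (3 ℕ.^ k)                                      ≡⟨ ℤP.pos-+ 1 (3 ℕ.^ k) ⟨
      + suc (3 ℕ.^ k)                                        ∎
      where open ≡-Reasoning

  module Subfaces (G : Subset n) (KG : K G ≡ true) (neG : Nonempty G) where
    open Interval G KG neG
    open IntervalIso (cube G KG neG)

    -- Count [∅,F] twice: by its own cube structure, and as the down-set of to F in [∅,G].
    dim≡freeCoords : ∀ F → K F ≡ true → (neF : Nonempty F) → F ⊆ G → ∀ w → to F ≡ just w → dim F ≡ freeCoords w
    dim≡freeCoords F KF neF F⊆G w toF≡w =
      3^-injective (dim F) (freeCoords w) (ℕP.suc-injective (ℤP.+-injective (trans (sym (Interval.size F KF neF)) size-in-G)))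
      where
      open ≡-Reasoning
      within-G : ∀ H → 𝟙[ does (H ⊆? F) ] (+ 1) ≡ 𝟙[ does (H ⊆? G) ] 𝟙[ does (H ⊆? F) ] (+ 1)
      within-G H with H ⊆? F
      ... | yes H⊆F rewrite dec-true (H ⊆? G) (⊆-trans H⊆F F⊆G) = refl
      ... | no _ = sym (𝟙-zero (does (H ⊆? G)))
      from⊆F⇔≤w : ∀ c → (from c ⊆ F) ⇔ (c ≤c just w)
      from⊆F⇔≤w c = mk⇔
        (λ (s : from c ⊆ F) → subst₂ _≤c_ (to-from c) toF≡w (Equivalence.to from-c-vs-F s))
        (λ c≤w → Equivalence.from from-c-vs-F (subst₂ _≤c_ (sym (to-from c)) (sym toF≡w) c≤w))
        where
        from-c-vs-F : (from c ⊆ F) ⇔ (to (from c) ≤c to F)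
        from-c-vs-F = mono (from c) F (proj₁ (from-in c)) (proj₂ (from-in c)) KF F⊆G
      size-in-G : ∑ subsets (λ H → 𝟙[ K H ] 𝟙[ does (H ⊆? F) ] (+ 1)) ≡ + suc (3 ℕ.^ freeCoords w)
      size-in-G = begin
        ∑ subsets (λ H → 𝟙[ K H ] 𝟙[ does (H ⊆? F) ] (+ 1))
          ≡⟨ ∑-cong subsets (λ H → 𝟙-cong (K H) (within-G H)) ⟩
        ∑ subsets (λ H → 𝟙[ K H ] 𝟙[ does (H ⊆? G) ] 𝟙[ does (H ⊆? F) ] (+ 1))
          ≡⟨ ∑-interval (λ H → 𝟙[ does (H ⊆? F) ] (+ 1)) ⟩
        ∑ (allCubeFaces k) (λ c → 𝟙[ does (from c ⊆? F) ] (+ 1))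
          ≡⟨ ∑-cong (allCubeFaces k) (λ c → cong (𝟙[_] (+ 1)) (does-⇔ (from⊆F⇔≤w c) (from c ⊆? F) (c ≤c? just w))) ⟩
        + 1 + ∑ (map just (cubeFaces k)) (λ c → 𝟙[ does (c ≤c? just w) ] (+ 1))
          ≡⟨ cong (_+_ (+ 1)) (trans (∑-map just (cubeFaces k) _) (∑-cubeFaces-≤ k w)) ⟩
        + 1 + + (3 ℕ.^ freeCoords w)
          ≡⟨ ℤP.pos-+ 1 (3 ℕ.^ freeCoords w) ⟨
        + suc (3 ℕ.^ freeCoords w) ∎

    dim-from-just : ∀ v → dim (from (just v)) ≡ freeCoords v
    dim-from-just v =
      dim≡freeCoords (from (just v)) (proj₁ (from-in (just v))) (from-just-nonempty v)
        (proj₂ (from-in (just v))) v (to-from (just v))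

    dim-mono : ∀ F → K F ≡ true → Nonempty F → F ⊆ G → dim F ≤ k
    dim-mono F KF neF F⊆G with to F in toF
    ... | just w = subst (_≤ k) (sym (dim≡freeCoords F KF neF F⊆G w toF)) (freeCoords≤ w)
    ... | nothing = contradiction (subst (proj₁ neF ∈_) F≡⊥ (proj₂ neF)) ∉⊥
      where
      F≡⊥ : F ≡ ⊥
      F≡⊥ = trans (sym (from-to F KF F⊆G)) (trans (cong from toF) from-nothing)

    ∑-faceTerm-interval : ∀ d j → k ≤ d →
      ∑ subsets (λ F → 𝟙[ isNEFace C F ] 𝟙[ does (F ⊆? G) ] faceTerm d (dim F) j) ≡ cubeTerm d k j
    ∑-faceTerm-interval d j k≤d = begin
      ∑ subsets (λ F → 𝟙[ isNEFace C F ] 𝟙[ does (F ⊆? G) ] faceTerm d (dim F) j)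
        ≡⟨ ∑-interval-nonempty (λ F → faceTerm d (dim F) j) ⟩
      ∑ (cubeFaces k) (λ v → faceTerm d (dim (from (just v))) j)
        ≡⟨ ∑-cong (cubeFaces k) (λ v → cong (λ i → faceTerm d i j) (dim-from-just v)) ⟩
      ∑ (cubeFaces k) (λ v → faceTerm d (freeCoords v) j)
        ≡⟨ ∑-faceTerm-cube-≤ j k≤d ⟩
      cubeTerm d k j ∎
      where open ≡-Reasoning

  -- fvec is defined through a where-bound helper that cannot be named; unification names it here.
  fvec-summand : ∀ i → Σ (Subset n → ℤ) λ h → fvec C i ≡ sumℤ subsets (isNEFace C) h
  fvec-summand i = _ , refl

  fvec≡∑ : ∀ i → fvec C i ≡ ∑ subsets (λ F → 𝟙[ isNEFace C F ] 𝟙[ does (dim F ℕ.≟ i) ] (+ 1))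
  fvec≡∑ i = trans (proj₂ (fvec-summand i))
    (trans (sumℤ≡∑ subsets (isNEFace C) _) (∑-cong subsets (λ F → 𝟙-cong (isNEFace C F) (summand F))))
    where
    summand : ∀ F → proj₁ (fvec-summand i) F ≡ 𝟙[ does (dim F ℕ.≟ i) ] (+ 1)
    summand F with dim F ℕ.≡ᵇ i
    ... | true = refl
    ... | false = refl

  linkSign : Subset n → Subset n → ℤ
  linkSign F G = sgn (+ dim G - + dim F - + 1)

  χ̃lk≡∑ : ∀ F → χ̃lk C F ≡ ∑ subsets (λ G → 𝟙[ isNEFace C G ] 𝟙[ does (F ⊆? G) ] linkSign F G)
  χ̃lk≡∑ F = trans (sumℤ≡∑ subsets _ _) (∑-cong subsets (λ G → 𝟙-∧ (isNEFace C G) (does (F ⊆? G)) _))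

  module OfDimension (d : ℕ) (isDim : IsDimension C d) where
    open ≡-Reasoning

    dim≤d : ∀ F → isNEFace C F ≡ true → dim F ≤ d
    dim≤d F F∈C = proj₁ isDim F (proj₁ (isNEFace-sound F F∈C)) (proj₂ (isNEFace-sound F F∈C))

    outerSign : Subset n → ℤ
    outerSign F = sgn (+ d - + dim F - + 1)

    signedCubeSum : ℕ → ℤ
    signedCubeSum j = ∑ subsets (λ F → 𝟙[ isNEFace C F ] (sgnℕ (d ∸ dim F) * cubeTerm d (dim F) j))

    hsc≡∑ : ∀ m → hsc C d m ≡ ∑ subsets (λ F → 𝟙[ isNEFace C F ] faceTerm d (dim F) m)
    hsc≡∑ m = begin
      hsc C d m
        ≡⟨ coeff-sumRange d _ m ⟩
      ∑≤ d (λ i → coeff (const (fvec C i) ⊗ (twoλ ^ₚ i) ⊗ (oneMinusλ ^ₚ (d ∸ i))) m)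
        ≡⟨ ∑≤-cong d (λ i _ → trans (coeff-const⊗⊗ (fvec C i) (twoλ ^ₚ i) (oneMinusλ ^ₚ (d ∸ i)) m) (count-by-dim i)) ⟩
      ∑≤ d (λ i → ∑ subsets (λ F → 𝟙[ isNEFace C F ] 𝟙[ does (dim F ℕ.≟ i) ] faceTerm d i m))
        ≡⟨ ∑≤-∑ d subsets _ ⟩
      ∑ subsets (λ F → ∑≤ d (λ i → 𝟙[ isNEFace C F ] 𝟙[ does (dim F ℕ.≟ i) ] faceTerm d i m))
        ≡⟨ ∑-cong subsets (λ F → trans (sym (𝟙-∑≤ (isNEFace C F) d _))
            (𝟙-cong (isNEFace C F) (∑≤-δ (dim F) d (λ i → faceTerm d i m)))) ⟩
      ∑ subsets (λ F → 𝟙[ isNEFace C F ] 𝟙[ does (dim F ≤? d) ] faceTerm d (dim F) m)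
        ≡⟨ ∑-cong subsets dim-in-range ⟩
      ∑ subsets (λ F → 𝟙[ isNEFace C F ] faceTerm d (dim F) m) ∎
      where
      count-by-dim : ∀ i → fvec C i * faceTerm d i m
        ≡ ∑ subsets (λ F → 𝟙[ isNEFace C F ] 𝟙[ does (dim F ℕ.≟ i) ] faceTerm d i m)
      count-by-dim i = begin
        fvec C i * faceTerm d i m
          ≡⟨ cong (_* faceTerm d i m) (fvec≡∑ i) ⟩
        ∑ subsets (λ F → 𝟙[ isNEFace C F ] 𝟙[ does (dim F ℕ.≟ i) ] (+ 1)) * faceTerm d i m
          ≡⟨ ∑-*ʳ (faceTerm d i m) subsets _ ⟩
        ∑ subsets (λ F → 𝟙[ isNEFace C F ] 𝟙[ does (dim F ℕ.≟ i) ] (+ 1) * faceTerm d i m)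
          ≡⟨ ∑-cong subsets (λ F → trans (𝟙²-*ʳ (faceTerm d i m) (isNEFace C F) (does (dim F ℕ.≟ i)) (+ 1))
               (𝟙-cong (isNEFace C F) (𝟙-cong (does (dim F ℕ.≟ i)) (ℤP.*-identityˡ _)))) ⟩
        ∑ subsets (λ F → 𝟙[ isNEFace C F ] 𝟙[ does (dim F ℕ.≟ i) ] faceTerm d i m) ∎
      dim-in-range : ∀ F → 𝟙[ isNEFace C F ] 𝟙[ does (dim F ≤? d) ] faceTerm d (dim F) m
        ≡ 𝟙[ isNEFace C F ] faceTerm d (dim F) m
      dim-in-range F with isNEFace C F in F∈C
      ... | true = cong (𝟙[_] faceTerm d (dim F) m) (dec-true (dim F ≤? d) (dim≤d F F∈C))
      ... | false = refl

    coeff-monomial : ∀ j m h → m ≤ d → coeff (const h ⊗ (X ^ₚ (d ∸ m))) j ≡ 𝟙[ does (j ≤? d) ] 𝟙[ does (d ∸ j ℕ.≟ m) ] h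
    coeff-monomial j m h m≤d = trans (coeff-const⊗ h (X ^ₚ (d ∸ m)) j)
      (trans (cong (h *_) (coeff-X^ (d ∸ m) j)) (by-range (j ≤? d)))
      where
      by-range : Dec (j ≤ d) → h * 𝟙[ does (j ℕ.≟ d ∸ m) ] (+ 1) ≡ 𝟙[ does (j ≤? d) ] 𝟙[ does (d ∸ j ℕ.≟ m) ] h
      by-range (yes j≤d) = begin
        h * 𝟙[ does (j ℕ.≟ d ∸ m) ] (+ 1)     ≡⟨ 𝟙-*ˡ h (does (j ℕ.≟ d ∸ m)) (+ 1) ⟩
        𝟙[ does (j ℕ.≟ d ∸ m) ] (h * + 1)
          ≡⟨ cong₂ 𝟙[_]_ (does-⇔ j≡d∸m⇔d∸j≡m (j ℕ.≟ d ∸ m) (d ∸ j ℕ.≟ m)) (ℤP.*-identityʳ h) ⟩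
        𝟙[ does (d ∸ j ℕ.≟ m) ] h             ≡⟨ cong (𝟙[_] 𝟙[ does (d ∸ j ℕ.≟ m) ] h) (dec-true (j ≤? d) j≤d) ⟨
        𝟙[ does (j ≤? d) ] 𝟙[ does (d ∸ j ℕ.≟ m) ] h ∎
        where
        j≡d∸m⇔d∸j≡m : (j ≡ d ∸ m) ⇔ (d ∸ j ≡ m)
        j≡d∸m⇔d∸j≡m = mk⇔ (λ j≡d∸m → trans (cong (d ∸_) j≡d∸m) (ℕP.m∸[m∸n]≡n m≤d))
                          (λ d∸j≡m → trans (sym (ℕP.m∸[m∸n]≡n j≤d)) (cong (d ∸_) d∸j≡m))
      by-range (no j≰d) = begin
        h * 𝟙[ does (j ℕ.≟ d ∸ m) ] (+ 1)     ≡⟨ cong (λ b → h * 𝟙[ b ] (+ 1)) (dec-false (j ℕ.≟ d ∸ m) j≢d∸m) ⟩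
        h * + 0                               ≡⟨ ℤP.*-zeroʳ h ⟩
        + 0                                   ≡⟨ cong (𝟙[_] 𝟙[ does (d ∸ j ℕ.≟ m) ] h) (dec-false (j ≤? d) j≰d) ⟨
        𝟙[ does (j ≤? d) ] 𝟙[ does (d ∸ j ℕ.≟ m) ] h ∎
        where
        j≢d∸m : ¬ j ≡ d ∸ m
        j≢d∸m j≡d∸m = j≰d (subst (_≤ d) (sym j≡d∸m) (ℕP.m∸n≤m d m))

    coeff-LHS : ∀ j → coeff (LHS C d) j ≡ signedCubeSum j
    coeff-LHS j = begin
      coeff (LHS C d) j
        ≡⟨ coeff-sumRange d _ j ⟩
      ∑≤ d (λ m → coeff (const (hsc C d m) ⊗ (X ^ₚ (d ∸ m))) j)
        ≡⟨ ∑≤-cong d (λ m m≤d → coeff-monomial j m (hsc C d m) m≤d) ⟩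
      ∑≤ d (λ m → 𝟙[ does (j ≤? d) ] 𝟙[ does (d ∸ j ℕ.≟ m) ] hsc C d m)
        ≡⟨ 𝟙-∑≤ (does (j ≤? d)) d _ ⟨
      𝟙[ does (j ≤? d) ] ∑≤ d (λ m → 𝟙[ does (d ∸ j ℕ.≟ m) ] hsc C d m)
        ≡⟨ 𝟙-cong (does (j ≤? d)) (trans (∑≤-δ (d ∸ j) d (hsc C d))
            (cong (𝟙[_] hsc C d (d ∸ j)) (dec-true (d ∸ j ≤? d) (ℕP.m∸n≤m d j)))) ⟩
      𝟙[ does (j ≤? d) ] hsc C d (d ∸ j)
        ≡⟨ 𝟙-cong (does (j ≤? d)) (hsc≡∑ (d ∸ j)) ⟩
      𝟙[ does (j ≤? d) ] ∑ subsets (λ F → 𝟙[ isNEFace C F ] faceTerm d (dim F) (d ∸ j))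
        ≡⟨ 𝟙-∑ (does (j ≤? d)) subsets _ ⟩
      ∑ subsets (λ F → 𝟙[ does (j ≤? d) ] 𝟙[ isNEFace C F ] faceTerm d (dim F) (d ∸ j))
        ≡⟨ ∑-cong subsets reflect ⟩
      signedCubeSum j ∎
      where
      reflect : ∀ F → 𝟙[ does (j ≤? d) ] 𝟙[ isNEFace C F ] faceTerm d (dim F) (d ∸ j)
                    ≡ 𝟙[ isNEFace C F ] (sgnℕ (d ∸ dim F) * cubeTerm d (dim F) j)
      reflect F with isNEFace C F in F∈C
      ... | true = faceTerm-reflect j (dim≤d F F∈C)
      ... | false = 𝟙-zero (does (j ≤? d))

    coeff-RHS-summand : ∀ F j →
      coeff (const (outerSign F * χ̃lk C F) ⊗ (twoλ ^ₚ dim F) ⊗ (oneMinusλ ^ₚ (d ∸ dim F))) j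
        ≡ ∑ subsets (λ G → 𝟙[ isNEFace C G ] 𝟙[ does (F ⊆? G) ] (outerSign F * linkSign F G * faceTerm d (dim F) j))
    coeff-RHS-summand F j = begin
      coeff (const (s * χ̃lk C F) ⊗ (twoλ ^ₚ dim F) ⊗ (oneMinusλ ^ₚ (d ∸ dim F))) j
        ≡⟨ coeff-const⊗⊗ (s * χ̃lk C F) (twoλ ^ₚ dim F) (oneMinusλ ^ₚ (d ∸ dim F)) j ⟩
      s * χ̃lk C F * t
        ≡⟨ cong (λ χ → s * χ * t) (χ̃lk≡∑ F) ⟩
      s * ∑ subsets (λ G → 𝟙[ isNEFace C G ] 𝟙[ does (F ⊆? G) ] linkSign F G) * t
        ≡⟨ cong (_* t) (∑-*ˡ s subsets _) ⟩
      ∑ subsets (λ G → s * 𝟙[ isNEFace C G ] 𝟙[ does (F ⊆? G) ] linkSign F G) * t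
        ≡⟨ ∑-*ʳ t subsets _ ⟩
      ∑ subsets (λ G → s * 𝟙[ isNEFace C G ] 𝟙[ does (F ⊆? G) ] linkSign F G * t)
        ≡⟨ ∑-cong subsets (λ G → trans (cong (_* t) (𝟙²-*ˡ s (isNEFace C G) (does (F ⊆? G)) (linkSign F G)))
            (𝟙²-*ʳ t (isNEFace C G) (does (F ⊆? G)) _)) ⟩
      ∑ subsets (λ G → 𝟙[ isNEFace C G ] 𝟙[ does (F ⊆? G) ] (s * linkSign F G * t)) ∎
      where
      s : ℤ
      s = outerSign F
      t : ℤ
      t = faceTerm d (dim F) j

    sign-collapse : ∀ F G j →
      𝟙[ isNEFace C F ] 𝟙[ isNEFace C G ] 𝟙[ does (F ⊆? G) ] (outerSign F * linkSign F G * faceTerm d (dim F) j)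
        ≡ 𝟙[ isNEFace C G ] 𝟙[ isNEFace C F ] 𝟙[ does (F ⊆? G) ] (sgnℕ (d ∸ dim G) * faceTerm d (dim F) j)
    sign-collapse F G j with isNEFace C F in F∈C | isNEFace C G in G∈C | F ⊆? G
    ... | true | true | yes F⊆G = cong (_* faceTerm d (dim F) j)
      (sgn-product (Subfaces.dim-mono G KG neG F KF neF F⊆G) (dim≤d G G∈C))
      where
      open Σ (isNEFace-sound F F∈C) renaming (proj₁ to KF; proj₂ to neF)
      open Σ (isNEFace-sound G G∈C) renaming (proj₁ to KG; proj₂ to neG)
    ... | true | true | no _ = refl
    ... | true | false | _ = refl
    ... | false | true | _ = refl
    ... | false | false | _ = refl

    ∑-faces-below : ∀ G j →
      ∑ subsets (λ F → 𝟙[ isNEFace C G ] 𝟙[ isNEFace C F ] 𝟙[ does (F ⊆? G) ] (sgnℕ (d ∸ dim G) * faceTerm d (dim F) j))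
        ≡ 𝟙[ isNEFace C G ] (sgnℕ (d ∸ dim G) * cubeTerm d (dim G) j)
    ∑-faces-below G j = begin
      ∑ subsets (λ F → 𝟙[ isNEFace C G ] 𝟙[ isNEFace C F ] 𝟙[ does (F ⊆? G) ] (s * faceTerm d (dim F) j))
        ≡⟨ 𝟙-∑ (isNEFace C G) subsets _ ⟨
      𝟙[ isNEFace C G ] ∑ subsets (λ F → 𝟙[ isNEFace C F ] 𝟙[ does (F ⊆? G) ] (s * faceTerm d (dim F) j))
        ≡⟨ 𝟙-cong (isNEFace C G) (∑-cong subsets (λ F → sym (𝟙²-*ˡ s (isNEFace C F) (does (F ⊆? G)) _))) ⟩
      𝟙[ isNEFace C G ] ∑ subsets (λ F → s * 𝟙[ isNEFace C F ] 𝟙[ does (F ⊆? G) ] faceTerm d (dim F) j)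
        ≡⟨ 𝟙-cong (isNEFace C G) (∑-*ˡ s subsets _) ⟨
      𝟙[ isNEFace C G ] (s * ∑ subsets (λ F → 𝟙[ isNEFace C F ] 𝟙[ does (F ⊆? G) ] faceTerm d (dim F) j))
        ≡⟨ interval G ⟩
      𝟙[ isNEFace C G ] (s * cubeTerm d (dim G) j) ∎
      where
      s : ℤ
      s = sgnℕ (d ∸ dim G)
      interval : ∀ G → 𝟙[ isNEFace C G ] (sgnℕ (d ∸ dim G)
          * ∑ subsets (λ F → 𝟙[ isNEFace C F ] 𝟙[ does (F ⊆? G) ] faceTerm d (dim F) j))
                     ≡ 𝟙[ isNEFace C G ] (sgnℕ (d ∸ dim G) * cubeTerm d (dim G) j)
      interval G with isNEFace C G in G∈C
      ... | false = refl
      ... | true = cong (sgnℕ (d ∸ dim G) *_) (Subfaces.∑-faceTerm-interval G KG neG d j (dim≤d G G∈C))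
        where open Σ (isNEFace-sound G G∈C) renaming (proj₁ to KG; proj₂ to neG)

    coeff-RHS : ∀ j → coeff (RHS C d) j ≡ signedCubeSum j
    coeff-RHS j = begin
      coeff (RHS C d) j
        ≡⟨ coeff-sumP subsets (isNEFace C) _ j ⟩
      ∑ subsets (λ F → 𝟙[ isNEFace C F ] coeff (summand F) j)
        ≡⟨ ∑-cong subsets (λ F → trans (𝟙-cong (isNEFace C F) (coeff-RHS-summand F j)) (𝟙-∑ (isNEFace C F) subsets _)) ⟩
      ∑ subsets (λ F → ∑ subsets (λ G → 𝟙[ isNEFace C F ] 𝟙[ isNEFace C G ] 𝟙[ does (F ⊆? G) ]
          (outerSign F * linkSign F G * t F)))
        ≡⟨ ∑-cong subsets (λ F → ∑-cong subsets (λ G → sign-collapse F G j)) ⟩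
      ∑ subsets (λ F → ∑ subsets (λ G → 𝟙[ isNEFace C G ] 𝟙[ isNEFace C F ] 𝟙[ does (F ⊆? G) ] (sgnℕ (d ∸ dim G) * t F)))
        ≡⟨ ∑-comm subsets subsets _ ⟩
      ∑ subsets (λ G → ∑ subsets (λ F → 𝟙[ isNEFace C G ] 𝟙[ isNEFace C F ] 𝟙[ does (F ⊆? G) ] (sgnℕ (d ∸ dim G) * t F)))
        ≡⟨ ∑-cong subsets (λ G → ∑-faces-below G j) ⟩
      signedCubeSum j ∎
      where
      summand : Subset n → Poly
      summand F = const (outerSign F * χ̃lk C F) ⊗ (twoλ ^ₚ dim F) ⊗ (oneMinusλ ^ₚ (d ∸ dim F))
      t : Subset n → ℤ
      t F = faceTerm d (dim F) j

lemma4p3 : (n : ℕ) (C : CubicalComplex n) (d : ℕ) → IsDimension C d →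
    LHS C d ≈ₚ RHS C d
lemma4p3 n C d isDim j = trans (coeff-LHS j) (sym (coeff-RHS j))
  where open Complex.OfDimension C d isDim
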